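{- Let $T$ be a tree of diameter at least three. Then any two non-adjacent vertices $x,y\in V(T)$ with $d_T(x,y)$ odd form a $k$-MARS $\{x,y\}$ for some $k\le 2$.
   Context: $d_T$ is the shortest-path distance. For $S\subseteq V(T)$ and $v\in V(T)$, $m(v|S)$ is the multiset $\{\!\{d_T(v,s): s\in S\}\!\}$. A nonempty set $S\subsetneq V(T)$ is a $k$-multiset antiresolving set ($k$-MARS) if $k$ equals the minimum size of an equivalence class of the relation on $V(T)\setminus S$ given by $u\sim v \iff m(u|S)=m(v|S)$. -}

module Defs where

open import Data.Nat using (ℕ; zero; suc; _≤_; _%_)
open import Data.Bool using (Bool; true; false; _∧_; _∨_; if_then_else_)
open import Data.Fin using (Fin; _≟_)
open import Data.List using (List; []; _∷_; [_]; _++_; length; map; allFin)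
open import Data.Bool.ListAction using (any)
open import Data.List.Membership.Propositional using (_∈_; _∉_)
open import Data.List.Relation.Unary.Unique.Propositional using (Unique)
open import Data.List.Relation.Binary.Permutation.Propositional using (_↭_)
open import Data.Product using (Σ; ∃; _×_; _,_)
open import Data.Unit using (⊤)
open import Function.Bundles using (_⇔_)
open import Relation.Nullary using (¬_)
open import Relation.Nullary.Decidable using (⌊_⌋)
open import Relation.Binary.PropositionalEquality using (_≡_)

record Graph (n : ℕ) : Set where
  field
    adj    : Fin n → Fin n → Bool
    sym    : ∀ u v → adj u v ≡ adj v u
    irrefl : ∀ u → adj u u ≡ false
open Graph public

module _ {n : ℕ} (G : Graph n) where

  reach : ℕ → Fin n → Fin n → Bool
  reach zero    u v = ⌊ u ≟ v ⌋
  reach (suc k) u v = reach k u v ∨ any (λ w → reach k u w ∧ adj G w v) (allFin n)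

  -- least f m : the least i < m with f i = true, or m if there is none.
  least : (ℕ → Bool) → ℕ → ℕ
  least f zero    = zero
  least f (suc m) = if f zero then zero else suc (least (λ i → f (suc i)) m)

  -- Shortest-path distance d_G(u,v): least k with a walk of length ≤ k
  -- (in a connected graph on n vertices this is < n, so the search bound n is harmless).
  dist : Fin n → Fin n → ℕ
  dist u v = least (λ k → reach k u v) n

  Connected : Set
  Connected = ∀ u v → ∃ λ k → reach k u v ≡ true

  Chain : List (Fin n) → Set
  Chain []           = ⊤
  Chain (x ∷ [])     = ⊤
  Chain (x ∷ y ∷ xs) = (adj G x y ≡ true) × Chain (y ∷ xs)

  -- a cycle v, m₁, …, m_j, w, (back to v) with j ≥ 1 (so length ≥ 3), all vertices distinct
  record Cycle : Set where
    field
      v w  : Fin n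
      mid  : List (Fin n)
      len  : 1 ≤ length mid
      uniq : Unique (v ∷ mid ++ [ w ])
      path : Chain (v ∷ mid ++ [ w ])
      close : adj G w v ≡ true

  IsTree : Set
  IsTree = Connected × ¬ Cycle

  DiameterAtLeast3 : Set
  DiameterAtLeast3 = ∃ λ u → ∃ λ v → 3 ≤ dist u v

  -- m(v|S), as a list; multiset equality is equality up to permutation (_↭_)
  mvec : List (Fin n) → Fin n → List ℕ
  mvec S v = map (dist v) S

  -- the equivalence class of v in V∖S (under u ~ v ⇔ m(u|S) = m(v|S)) has exactly k elements
  ClassSize : List (Fin n) → Fin n → ℕ → Set
  ClassSize S v k =
    Σ (List (Fin n)) λ L → Unique L × length L ≡ k ×
      (∀ w → (w ∈ L) ⇔ ((w ∉ S) × (mvec S w ↭ mvec S v)))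

  IsMARS : List (Fin n) → ℕ → Set
  IsMARS S k =
    Unique S ×
    ¬ (S ≡ []) ×
    (∃ λ u → u ∉ S) ×
    (∃ λ v → (v ∉ S) × ClassSize S v k) ×
    (∀ v j → v ∉ S → ClassSize S v j → k ≤ j)

-- Let d = d(x,y); it is odd and x, y are not adjacent, so d ≥ 3. Let p and q be the neighbours
-- of x and y on the x–y path. Then m(p|S) = m(q|S) = {1, d−1} for S = {x, y}, and p ≠ q.
-- Conversely a vertex w with m(w|S) = {1, d−1} is a neighbour of x closer to y, or of y closer
-- to x; in a tree there is only one such neighbour (two of them would close a cycle through x,
-- resp. y), so w ∈ {p, q}. Thus {p, q} is a class of size 2, and the least class size is 1 or 2.

{-# OPTIONS --safe #-}
module Submission where

open import Defs hiding (sym)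
open import Data.Bool using (Bool; true; false; T)
open import Data.Bool.Properties using (T-≡; T-∨; T-∧)
open import Data.Empty using (⊥-elim)
open import Data.Fin using (Fin; _≟_)
import Data.Fin as Fin
open import Data.Fin.Properties using (any?; injective⇒≤)
open import Data.List as List using (List; []; _∷_; [_]; _++_; length; lookup; allFin)
open import Data.List.Properties using (unfold-reverse)
open import Data.List.Membership.Propositional using (_∈_; _∉_; lose)
open import Data.List.Membership.Propositional.Properties using (∈-allFin; ∈-lookup; ∈-++⁺ʳ)
import Data.List.Membership.DecPropositional as DecMembership
open import Data.List.Relation.Unary.Any using (here; there; satisfied)
open import Data.List.Relation.Unary.Any.Properties using (any⁺; any⁻; reverse⁻)
open import Data.List.Relation.Unary.All using ([]; _∷_)
import Data.List.Relation.Unary.All as All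
open import Data.List.Relation.Unary.All.Properties.Core using (¬Any⇒All¬)
open import Data.List.Relation.Unary.AllPairs using ([]; _∷_)
open import Data.List.Relation.Unary.Unique.Propositional using (Unique)
open import Data.List.Relation.Binary.Subset.Propositional using (_⊆_)
open import Data.List.Relation.Binary.Permutation.Propositional using (_↭_; ↭-refl; ↭-trans; swap)
open import Data.List.Relation.Binary.Permutation.Propositional.Properties using (∈-resp-↭; drop-∷; ↭-singleton-inv)
open import Data.Nat as ℕ using (ℕ; zero; suc; _+_; _≤_; _<_; _%_; z≤n; s≤s; s≤s⁻¹)
open import Data.Nat.Properties using (≤-refl; ≤-antisym; ≤-reflexive; ≤-<-trans; m≤n⇒m≤1+n; n≤0⇒n≡0; suc-injective; <⇒≢; ≤-trans; ≤⇒≯)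
open import Data.Product using (∃; ∃₂; _×_; _,_; proj₂)
open import Data.Sum using (_⊎_; inj₁; inj₂)
import Data.Sum as Sum
open import Function using (_∘_; id)
open import Function.Bundles using (mk⇔; Equivalence)
open import Function.Definitions using (Injective)
open import Relation.Binary.Definitions using (DecidableEquality)
open import Relation.Nullary using (¬_; Dec; yes; no; contradiction)
open import Relation.Nullary.Decidable using (map′; _×-dec_; _⊎-dec_; ¬?; toWitness; fromWitness; decidable-stable)
open import Relation.Binary.PropositionalEquality using (_≡_; _≢_; refl; sym; trans; cong; subst; module ≡-Reasoning)

open Equivalence using (to; from)

private variable
  A : Set

↭-pair⁺ : {a b c d : A} → (a ≡ c × b ≡ d) ⊎ (a ≡ d × b ≡ c) → (a ∷ b ∷ []) ↭ (c ∷ d ∷ [])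
↭-pair⁺ (inj₁ (refl , refl)) = ↭-refl
↭-pair⁺ (inj₂ (refl , refl)) = swap _ _ ↭-refl

↭-pair⁻ : {a b c d : A} → (a ∷ b ∷ []) ↭ (c ∷ d ∷ []) → (a ≡ c × b ≡ d) ⊎ (a ≡ d × b ≡ c)
↭-pair⁻ {c = c} ρ with ∈-resp-↭ ρ (here refl)
... | here refl with refl ← ↭-singleton-inv (drop-∷ ρ) = inj₁ (refl , refl)
... | there (here refl) with refl ← ↭-singleton-inv (drop-∷ (↭-trans ρ (swap c _ ↭-refl))) = inj₂ (refl , refl)

↭-pair? : DecidableEquality A → (a b c d : A) → Dec ((a ∷ b ∷ []) ↭ (c ∷ d ∷ []))
↭-pair? _≟ᴬ_ a b c d = map′ ↭-pair⁺ ↭-pair⁻ ((a ≟ᴬ c ×-dec b ≟ᴬ d) ⊎-dec (a ≟ᴬ d ×-dec b ≟ᴬ c))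

∈⇒1≤length : {x : A} {xs : List A} → x ∈ xs → 1 ≤ length xs
∈⇒1≤length {xs = _ ∷ _} _ = s≤s z≤n

distinct-∈⇒2≤length : {x y : A} {xs : List A} → x ∈ xs → y ∈ xs → x ≢ y → 2 ≤ length xs
distinct-∈⇒2≤length {xs = _ ∷ _ ∷ _} _ _ _ = s≤s (s≤s z≤n)
distinct-∈⇒2≤length {xs = _ ∷ []} (here refl) (here refl) x≢y = contradiction refl x≢y

Unique-++⁻ʳ : (xs : List A) {ys : List A} → Unique (xs ++ ys) → Unique ys
Unique-++⁻ʳ []       ys! = ys!
Unique-++⁻ʳ (_ ∷ xs) (_ ∷ xs++ys!) = Unique-++⁻ʳ xs xs++ys!

Unique⇒lookup-injective : {xs : List A} → Unique xs → Injective _≡_ _≡_ (lookup xs)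
Unique⇒lookup-injective (_  ∷ _)   {Fin.zero}  {Fin.zero}  _  = refl
Unique⇒lookup-injective (x≢ ∷ _)   {Fin.zero}  {Fin.suc j} eq = contradiction eq (All.lookup x≢ (∈-lookup j))
Unique⇒lookup-injective (x≢ ∷ _)   {Fin.suc i} {Fin.zero}  eq = contradiction (sym eq) (All.lookup x≢ (∈-lookup i))
Unique⇒lookup-injective (_  ∷ xs!) {Fin.suc i} {Fin.suc j} eq = cong Fin.suc (Unique⇒lookup-injective xs! eq)

Unique⇒length≤ : {n : ℕ} {xs : List (Fin n)} → Unique xs → length xs ≤ n
Unique⇒length≤ xs! = injective⇒≤ (Unique⇒lookup-injective xs!)

module _ {n : ℕ} (G : Graph n) (S : List (Fin n)) where

  private variable
    v w p q : Fin n
    j : ℕ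

  Twin : Fin n → Fin n → Set
  Twin v w = w ≢ v × w ∉ S × mvec G S w ↭ mvec G S v

  twin? : (∀ v w → Dec (mvec G S w ↭ mvec G S v)) → ∀ v w → Dec (Twin v w)
  twin? ≈? v w = ¬? (w ≟ v) ×-dec ¬? (w ∈? S) ×-dec ≈? v w
    where open DecMembership _≟_

  ClassSize⇒1≤ : v ∉ S → ClassSize G S v j → 1 ≤ j
  ClassSize⇒1≤ v∉S (_ , _ , refl , class) = ∈⇒1≤length (from (class _) (v∉S , ↭-refl))

  Twin⇒2≤ClassSize : v ∉ S → Twin v w → ClassSize G S v j → 2 ≤ j
  Twin⇒2≤ClassSize v∉S (w≢v , w∉S , w≈v) (_ , _ , refl , class) =
    distinct-∈⇒2≤length (from (class _) (v∉S , ↭-refl)) (from (class _) (w∉S , w≈v)) (w≢v ∘ sym)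

  twinless⇒ClassSize1 : v ∉ S → ¬ ∃ (Twin v) → ClassSize G S v 1
  twinless⇒ClassSize1 {v} v∉S twinless = [ v ] , [] ∷ [] , refl , λ w → mk⇔ (member w) (only w)
    where
    member : ∀ w → w ∈ [ v ] → w ∉ S × mvec G S w ↭ mvec G S v
    member _ (here refl) = v∉S , ↭-refl
    only : ∀ w → w ∉ S × mvec G S w ↭ mvec G S v → w ∈ [ v ]
    only w (w∉S , w≈v) with w ≟ v
    ... | yes w≡v = here w≡v
    ... | no  w≢v = contradiction (w , w≢v , w∉S , w≈v) twinless

  ClassSize-pair : p ≢ q → p ∉ S → q ∉ S → mvec G S q ↭ mvec G S p →
                   (∀ w → w ∉ S → mvec G S w ↭ mvec G S p → w ≡ p ⊎ w ≡ q) →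
                   ClassSize G S p 2
  ClassSize-pair {p} {q} p≢q p∉S q∉S q≈p only =
    p ∷ q ∷ [] , (p≢q ∷ []) ∷ [] ∷ [] , refl , λ w → mk⇔ (member w) (λ (w∉S , w≈p) → Sum.[ here , there ∘ here ]′ (only w w∉S w≈p))
    where
    member : ∀ w → w ∈ p ∷ q ∷ [] → w ∉ S × mvec G S w ↭ mvec G S p
    member _ (here refl)         = p∉S , ↭-refl
    member _ (there (here refl)) = q∉S , q≈p

  ClassSize2⇒MARS : (∀ v w → Dec (mvec G S w ↭ mvec G S v)) → Unique S → S ≢ [] →
                    p ∉ S → ClassSize G S p 2 → ∃ λ k → k ≤ 2 × IsMARS G S k
  ClassSize2⇒MARS ≈? S! S≢[] p∉S p-class with any? (λ v → ¬? (v ∈? S) ×-dec ¬? (any? (twin? ≈? v)))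
    where open DecMembership _≟_
  ... | yes (v , v∉S , twinless) =
    1 , s≤s z≤n , S! , S≢[] , (_ , p∉S) , (v , v∉S , twinless⇒ClassSize1 v∉S twinless) , λ _ _ → ClassSize⇒1≤
  ... | no ∄twinless =
    2 , ≤-refl , S! , S≢[] , (_ , p∉S) , (_ , p∉S , p-class) , λ v _ v∉S → Twin⇒2≤ClassSize v∉S (proj₂ (has-twin v∉S))
    where
    has-twin : v ∉ S → ∃ (Twin v)
    has-twin {v} v∉S = decidable-stable (any? (twin? ≈? v)) (λ ∄twin → ∄twinless (v , v∉S , ∄twin))

module _ {n : ℕ} (G : Graph n) where

  private variable
    u v w w′ a b x y p q : Fin n
    j k : ℕ

  least-≤ : ∀ (f : ℕ → Bool) m i → T (f i) → least G f m ≤ i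
  least-≤ f zero    i       _ = z≤n
  least-≤ f (suc m) zero    h with f zero
  ... | true  = z≤n
  ... | false = ⊥-elim h
  least-≤ f (suc m) (suc i) h with f zero
  ... | true  = z≤n
  ... | false = s≤s (least-≤ (f ∘ suc) m i h)

  least-satisfies : ∀ (f : ℕ → Bool) m → least G f m < m → T (f (least G f m))
  least-satisfies f (suc m) lt with f zero in eq
  ... | true  = from T-≡ eq
  ... | false = least-satisfies (f ∘ suc) m (s≤s⁻¹ lt)

  adj-sym : adj G u v ≡ true → adj G v u ≡ true
  adj-sym {u} {v} e = trans (Graph.sym G v u) e

  adj⇒≢ : adj G u v ≡ true → u ≢ v
  adj⇒≢ {u} e refl with trans (sym e) (irrefl G u)
  ... | ()

  infixr 5 _∷_
  data Walk : Fin n → Fin n → ℕ → Set where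
    []  : Walk u u 0
    _∷_ : adj G u w ≡ true → Walk w v k → Walk u v (suc k)

  verts : Walk u v k → List (Fin n)
  verts {u = u} []      = [ u ]
  verts {u = u} (_ ∷ W) = u ∷ verts W

  initVerts : Walk u v k → List (Fin n)
  initVerts []              = []
  initVerts {u = u} (_ ∷ W) = u ∷ initVerts W

  verts≡initVerts++ : (W : Walk u v k) → verts W ≡ initVerts W ++ [ v ]
  verts≡initVerts++ []      = refl
  verts≡initVerts++ (_ ∷ W) = cong (_ ∷_) (verts≡initVerts++ W)

  length-verts : (W : Walk u v k) → length (verts W) ≡ suc k
  length-verts []      = refl
  length-verts (_ ∷ W) = cong suc (length-verts W)

  chain-verts : (W : Walk u v k) → Chain G (verts W)
  chain-verts []           = _
  chain-verts (e ∷ [])     = e , _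
  chain-verts (e ∷ e′ ∷ W) = e , chain-verts (e′ ∷ W)

  infixl 5 _∷ʳ_
  _∷ʳ_ : Walk u w k → adj G w v ≡ true → Walk u v (suc k)
  []       ∷ʳ e = e ∷ []
  (e′ ∷ W) ∷ʳ e = e′ ∷ (W ∷ʳ e)

  verts-∷ʳ : (W : Walk u w k) (e : adj G w v ≡ true) → verts (W ∷ʳ e) ≡ verts W ++ [ v ]
  verts-∷ʳ []       e = refl
  verts-∷ʳ (e′ ∷ W) e = cong (_ ∷_) (verts-∷ʳ W e)

  unsnoc : Walk u v (suc k) → ∃ λ w → Walk u w k × adj G w v ≡ true
  unsnoc (e ∷ [])     = _ , [] , e
  unsnoc (e ∷ e′ ∷ W) = let w , W′ , e″ = unsnoc (e′ ∷ W) in w , e ∷ W′ , e″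

  reverse : Walk u v k → Walk v u k
  reverse []      = []
  reverse (e ∷ W) = reverse W ∷ʳ adj-sym e

  verts-reverse : (W : Walk u v k) → verts (reverse W) ≡ List.reverse (verts W)
  verts-reverse []                = refl
  verts-reverse {u = u} (e ∷ W) = begin
    verts (reverse W ∷ʳ adj-sym e)      ≡⟨ verts-∷ʳ (reverse W) (adj-sym e) ⟩
    verts (reverse W) ++ [ u ]          ≡⟨ cong (_++ [ u ]) (verts-reverse W) ⟩
    List.reverse (verts W) ++ [ u ]     ≡⟨ sym (unfold-reverse u (verts W)) ⟩
    List.reverse (u ∷ verts W)          ∎
    where open ≡-Reasoning

  ∈-reverse⁻ : (W : Walk u v k) → a ∈ verts (reverse W) → a ∈ verts W
  ∈-reverse⁻ W = reverse⁻ ∘ subst (_ ∈_) (verts-reverse W)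

  infixr 5 _++ʷ_
  _++ʷ_ : Walk u w j → Walk w v k → Walk u v (j + k)
  []      ++ʷ W′ = W′
  (e ∷ W) ++ʷ W′ = e ∷ (W ++ʷ W′)

  ∈-++ʷ⁻ : (W : Walk u w j) (W′ : Walk w v k) → a ∈ verts (W ++ʷ W′) → a ∈ verts W ⊎ a ∈ verts W′
  ∈-++ʷ⁻ []      W′ a∈       = inj₂ a∈
  ∈-++ʷ⁻ (_ ∷ W) W′ (here eq) = inj₁ (here eq)
  ∈-++ʷ⁻ (_ ∷ W) W′ (there a∈) = Sum.map₁ there (∈-++ʷ⁻ W W′ a∈)

  dropTo : (W : Walk u v k) → a ∈ verts W →
           ∃₂ λ j (W′ : Walk a v j) → j ≤ k × ∃ λ xs → verts W ≡ xs ++ verts W′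
  dropTo []      (here refl) = _ , [] , z≤n , [] , refl
  dropTo (e ∷ W) (here refl) = _ , e ∷ W , ≤-refl , [] , refl
  dropTo {u = u} (_ ∷ W) (there a∈) =
    let j , W′ , j≤k , xs , eq = dropTo W a∈ in j , W′ , m≤n⇒m≤1+n j≤k , u ∷ xs , cong (u ∷_) eq

  shorten : (W : Walk u v k) → ∃₂ λ j (P : Walk u v j) → Unique (verts P) × verts P ⊆ verts W
  shorten [] = _ , [] , [] ∷ [] , id
  shorten {u = u} (e ∷ W) with _ , P , P! , P⊆W ← shorten W | u ∈? verts P
    where open DecMembership _≟_
  ... | yes u∈P = let _ , P′ , _ , xs , eq = dropTo P u∈P in
    _ , P′ , Unique-++⁻ʳ xs (subst Unique eq P!) , there ∘ P⊆W ∘ subst (_ ∈_) (sym eq) ∘ ∈-++⁺ʳ xs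
  ... | no u∉P = _ , e ∷ P , ¬Any⇒All¬ _ u∉P ∷ P! , λ { (here eq) → here eq ; (there a∈) → there (P⊆W a∈) }

  path⇒cycle : (P : Walk u v k) → Unique (verts P) → u ≢ v → a ∉ verts P →
               adj G a u ≡ true → adj G v a ≡ true → Cycle G
  path⇒cycle []          _  u≢v _   _  _  = contradiction refl u≢v
  path⇒cycle {v = v} {a = a} P@(_ ∷ _) P! _ a∉P au va = record
    { v     = a
    ; w     = v
    ; mid   = initVerts P
    ; len   = s≤s z≤n
    ; uniq  = subst (λ vs → Unique (a ∷ vs)) (verts≡initVerts++ P) (¬Any⇒All¬ _ a∉P ∷ P!)
    ; path  = subst (λ vs → Chain G (a ∷ vs)) (verts≡initVerts++ P) (au , chain-verts P)
    ; close = va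
    }

  walk⇒cycle : (W : Walk u v k) → u ≢ v → a ∉ verts W → adj G a u ≡ true → adj G v a ≡ true → Cycle G
  walk⇒cycle W u≢v a∉W = let _ , P , P! , P⊆W = shorten W in path⇒cycle P P! u≢v (a∉W ∘ P⊆W)

  reach⇒walk : ∀ k → T (reach G k u v) → ∃ λ j → j ≤ k × Walk u v j
  reach⇒walk zero r with refl ← toWitness r = _ , z≤n , []
  reach⇒walk (suc k) r with to T-∨ r
  ... | inj₁ r′ = let j , j≤k , W = reach⇒walk k r′ in j , m≤n⇒m≤1+n j≤k , W
  ... | inj₂ r′ =
    let w , rw      = satisfied (any⁻ _ (allFin n) r′)
        r″ , e      = to T-∧ rw
        j , j≤k , W = reach⇒walk k r″
    in suc j , s≤s j≤k , W ∷ʳ to T-≡ e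

  walk⇒reach : Walk u v k → T (reach G k u v)
  walk⇒reach []          = fromWitness refl
  walk⇒reach W@(_ ∷ _) =
    let w , W′ , e = unsnoc W
    in from T-∨ (inj₂ (any⁺ _ (lose (∈-allFin w) (from T-∧ (walk⇒reach W′ , from T-≡ e)))))

  walk⇒dist≤ : Walk u v k → dist G u v ≤ k
  walk⇒dist≤ {u} {v} {k} W = least-≤ (λ i → reach G i u v) n k (walk⇒reach W)

  dist-refl : dist G u u ≡ 0
  dist-refl = n≤0⇒n≡0 (walk⇒dist≤ [])

  0<dist⇒≢ : 0 < dist G u v → u ≢ v
  0<dist⇒≢ 0<d refl = <⇒≢ 0<d (sym dist-refl)

  ∈-verts⇒dist≤ : (W : Walk u v k) → a ∈ verts W → dist G a v ≤ k
  ∈-verts⇒dist≤ W a∈ = let _ , W′ , j≤k , _ = dropTo W a∈ in ≤-trans (walk⇒dist≤ W′) j≤k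

  avoids : (W : Walk u v k) → k < dist G a v → a ∉ verts W
  avoids W k<d a∈ = ≤⇒≯ (∈-verts⇒dist≤ W a∈) k<d

  module _ (connected : Connected G) where

    dist<n : dist G u v < n
    dist<n {u} {v} =
      let k , r     = connected u v
          _ , _ , W = reach⇒walk k (from T-≡ r)
          _ , P , P! , _ = shorten W
      in ≤-<-trans (walk⇒dist≤ P) (subst (_≤ n) (length-verts P) (Unique⇒length≤ P!))

    geodesic : Walk u v (dist G u v)
    geodesic {u} {v} =
      let j , j≤d , W = reach⇒walk _ (least-satisfies (λ i → reach G i u v) n dist<n)
      in subst (Walk u v) (≤-antisym j≤d (walk⇒dist≤ W)) W

    dist-sym : dist G u v ≡ dist G v u
    dist-sym = ≤-antisym (walk⇒dist≤ (reverse geodesic)) (walk⇒dist≤ (reverse geodesic))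

    dist≡0⇒≡ : dist G u v ≡ 0 → u ≡ v
    dist≡0⇒≡ {u} {v} d≡0 with subst (Walk u v) d≡0 geodesic
    ... | [] = refl

    dist≡1⇒adj : dist G u v ≡ 1 → adj G u v ≡ true
    dist≡1⇒adj {u} {v} d≡1 with subst (Walk u v) d≡1 geodesic
    ... | e ∷ [] = e

    adj⇒dist≡1 : adj G u v ≡ true → dist G u v ≡ 1
    adj⇒dist≡1 {u} {v} e with dist G u v in d≡ | walk⇒dist≤ (e ∷ [])
    ... | zero        | _      = contradiction (dist≡0⇒≡ d≡) (adj⇒≢ e)
    ... | suc zero    | _      = refl
    ... | suc (suc _) | s≤s ()

    odd-nonadjacent⇒3≤dist : adj G u v ≡ false → dist G u v % 2 ≡ 1 → 3 ≤ dist G u v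
    odd-nonadjacent⇒3≤dist {u} {v} u≁v odd with dist G u v in d≡
    odd-nonadjacent⇒3≤dist u≁v () | zero
    ... | suc zero = contradiction (trans (sym (dist≡1⇒adj d≡)) u≁v) λ ()
    odd-nonadjacent⇒3≤dist u≁v () | suc (suc zero)
    ... | suc (suc (suc _)) = s≤s (s≤s (s≤s z≤n))

    closer-neighbour : u ≢ v → ∃ λ p → adj G u p ≡ true × suc (dist G p v) ≡ dist G u v
    closer-neighbour {u} {v} u≢v with dist G u v in d≡ | geodesic {u} {v}
    ... | zero  | _ = contradiction (dist≡0⇒≡ d≡) u≢v
    ... | suc k | _∷_ {w = p} e W =
      p , e , ≤-antisym (s≤s (walk⇒dist≤ W)) (subst (_≤ suc (dist G p v)) d≡ (walk⇒dist≤ (e ∷ geodesic)))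

    module _ (acyclic : ¬ Cycle G) where

      closer-neighbour-unique : adj G a w ≡ true → adj G a w′ ≡ true →
                                dist G w b < dist G a b → dist G w′ b < dist G a b → w ≡ w′
      -- Otherwise the geodesics from w and w′ to b, too short to pass through a, close a cycle through a.
      closer-neighbour-unique {a} {w} {w′} {b} aw aw′ w-closer w′-closer with w ≟ w′
      ... | yes w≡w′ = w≡w′
      ... | no  w≢w′ = contradiction (walk⇒cycle W w≢w′ a∉W aw (adj-sym aw′)) acyclic
        where
        W : Walk w w′ (dist G w b + dist G w′ b)
        W = geodesic ++ʷ reverse geodesic
        a∉W : a ∉ verts W
        a∉W a∈ with ∈-++ʷ⁻ geodesic (reverse geodesic) a∈
        ... | inj₁ a∈₁ = avoids geodesic w-closer a∈₁
        ... | inj₂ a∈₂ = avoids geodesic w′-closer (∈-reverse⁻ geodesic a∈₂)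

      closer-neighbours-class : adj G x p ≡ true → suc (dist G p y) ≡ dist G x y →
                                adj G y q ≡ true → suc (dist G q x) ≡ dist G y x →
                                3 ≤ dist G x y → p ∉ x ∷ y ∷ [] × ClassSize G (x ∷ y ∷ []) p 2
      closer-neighbours-class {x} {p} {y} {q} xp p-closer yq q-closer 3≤d =
        p∉S , ClassSize-pair G S p≢q p∉S q∉S (↭-pair⁺ (inj₂ (qx≡py , qy≡px))) only
        where
        S : List (Fin n)
        S = x ∷ y ∷ []
        px≡1 : dist G p x ≡ 1
        px≡1 = adj⇒dist≡1 (adj-sym xp)
        qy≡px : dist G q y ≡ dist G p x
        qy≡px = trans (adj⇒dist≡1 (adj-sym yq)) (sym px≡1)
        qx≡py : dist G q x ≡ dist G p y
        qx≡py = suc-injective (trans q-closer (trans dist-sym (sym p-closer)))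
        2≤py : 2 ≤ dist G p y
        2≤py = s≤s⁻¹ (subst (3 ≤_) (sym p-closer) 3≤d)
        0<px : 0 < dist G p x
        0<px = ≤-reflexive (sym px≡1)
        0<py : 0 < dist G p y
        0<py = ≤-trans (s≤s z≤n) 2≤py
        ∉S : 0 < dist G w x → 0 < dist G w y → w ∉ S
        ∉S 0<wx _ (here w≡x)         = 0<dist⇒≢ 0<wx w≡x
        ∉S _ 0<wy (there (here w≡y)) = 0<dist⇒≢ 0<wy w≡y
        p∉S : p ∉ S
        p∉S = ∉S 0<px 0<py
        q∉S : q ∉ S
        q∉S = ∉S (subst (0 <_) (sym qx≡py) 0<py) (subst (0 <_) (sym qy≡px) 0<px)
        p≢q : p ≢ q
        p≢q refl with subst (2 ≤_) (trans qy≡px px≡1) 2≤py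
        ... | s≤s ()
        only : ∀ w → w ∉ S → mvec G S w ↭ mvec G S p → w ≡ p ⊎ w ≡ q
        only w _ w≈p with ↭-pair⁻ w≈p
        ... | inj₁ (wx≡px , wy≡py) = inj₁ (closer-neighbour-unique
          (adj-sym (dist≡1⇒adj (trans wx≡px px≡1))) xp
          (subst (_< dist G x y) (sym wy≡py) (≤-reflexive p-closer)) (≤-reflexive p-closer))
        ... | inj₂ (wx≡py , wy≡px) = inj₂ (closer-neighbour-unique
          (adj-sym (dist≡1⇒adj (trans wy≡px px≡1))) yq
          (subst (_< dist G y x) (sym (trans wx≡py (sym qx≡py))) (≤-reflexive q-closer)) (≤-reflexive q-closer))

lemma10 : (n : ℕ) (T : Graph n) → IsTree T → DiameterAtLeast3 T →
          (x y : Fin n) → adj T x y ≡ false → dist T x y % 2 ≡ 1 →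
          ∃ λ k → k ≤ 2 × IsMARS T (x ∷ y ∷ []) k
lemma10 n T (connected , acyclic) _ x y x≁y odd =
  let 3≤d               = odd-nonadjacent⇒3≤dist T connected x≁y odd
      x≢y               = 0<dist⇒≢ T (≤-trans (s≤s z≤n) 3≤d)
      p , xp , p-closer = closer-neighbour T connected x≢y
      q , yq , q-closer = closer-neighbour T connected (x≢y ∘ sym)
      p∉S , p-class     = closer-neighbours-class T connected acyclic xp p-closer yq q-closer 3≤d
  in ClassSize2⇒MARS T (x ∷ y ∷ []) (λ _ _ → ↭-pair? ℕ._≟_ _ _ _ _) ((x≢y ∷ []) ∷ [] ∷ []) (λ ()) p∉S p-class
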